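{- Let $\mathbb{F}$ be a field of characteristic $2$ and $S=\{R_0,\dots,R_d\}$ a quasi-thin association scheme on a finite set $X$. Let $\langle v\rangle_{\mathbb{F}}$ be a trivial $\mathbb{F}S$-submodule of the regular $\mathbb{F}S$-module. If $R_0\in U(v)$, then $U(v)$ is a singular subset of $S$.
   Context: $S$ is an association scheme on $X$ with diagonal $R_0$, transposes $R_{i^*}$, intersection numbers $p_{ij}^k$, valencies $k_i=p_{ii^*}^0$; quasi-thin means $k_i\le2$ for all $i$. For nonempty $U,V\subseteq S$, $UV=\{R_k:\exists R_u\in U,R_v\in V,\ p_{uv}^k>0\}$ ($R_i$ stands for $\{R_i\}$). $O_\vartheta(S)=\{R_i:k_i=1\}$. A subset $T\subseteq S$ is singular if (i) $O_\vartheta(S)\subseteq T$ and (ii) $R_xR_{y^*}R_yR_z\subseteq T$ for all $R_x\in O_\vartheta(S)$, $R_y\in S$, $R_z\in T$. $\overline{A_i}$ is the image in $M_X(\mathbb{F})$ of the adjacency matrix of $R_i$, $\mathbb{F}S=\mathrm{span}_{\mathbb{F}}\{\overline{A_i}\}$ (basis $\overline{A_0},\dots,\overline{A_d}$), $\overline{k_i}$ the image of $k_i$ in $\mathbb{F}$. For $v=\sum c_i\overline{A_i}$, $U(v)=\{R_i:c_i\ne0\}$. A trivial submodule of the regular module is $\langle v\rangle_{\mathbb{F}}$ with $0\ne v\in\mathbb{F}S$ and $\overline{A_i}v=\overline{k_i}v$ for all $i$. -}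

module Defs where

open import Level using (Level; _⊔_)
open import Data.Nat using (ℕ; zero; suc; _<_; _≤_) renaming (_+_ to _+ℕ_)
open import Data.Fin using (Fin) renaming (zero to fzero; suc to fsuc)
open import Data.Fin.Properties using (_≟_)
open import Data.Bool using (Bool; true; false; if_then_else_; _∧_)
open import Data.Product using (Σ; ∃; ∃-syntax; _×_; _,_)
open import Relation.Nullary using (¬_; does)
open import Relation.Binary.PropositionalEquality using (_≡_)
open import Function.Bundles using (_⇔_)
open import Algebra.Bundles using (CommutativeRing)

count : {n : ℕ} → (Fin n → Bool) → ℕ
count {zero}  P = 0
count {suc n} P = (if P fzero then 1 else 0) +ℕ count (λ z → P (fsuc z))

-- An association scheme S = {R_0,…,R_d} on X = Fin n.
-- rel x y = i  means  (x,y) ∈ R_i ; R_0 is the diagonal (index fzero).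
record AssocScheme (n d : ℕ) : Set where
  field
    rel      : Fin n → Fin n → Fin (suc d)
    nonempty : ∀ i → ∃[ x ] ∃[ y ] rel x y ≡ i
    diagonal : ∀ x y → (rel x y ≡ fzero) ⇔ (x ≡ y)
    _*       : Fin (suc d) → Fin (suc d)
    transp   : ∀ x y → rel y x ≡ (rel x y) *
    p        : Fin (suc d) → Fin (suc d) → Fin (suc d) → ℕ
    p-count  : ∀ i j k x y → rel x y ≡ k →
               count (λ z → does (rel x z ≟ i) ∧ does (rel z y ≟ j)) ≡ p i j k

  valency : Fin (suc d) → ℕ
  valency i = p i (i *) fzero

  _⊙_ : (Fin (suc d) → Set) → (Fin (suc d) → Set) → Fin (suc d) → Set
  (U ⊙ V) k = ∃[ u ] ∃[ v ] (U u × V v × 0 < p u v k)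

  ⟦_⟧ : Fin (suc d) → Fin (suc d) → Set
  ⟦ i ⟧ j = i ≡ j

  Othin : Fin (suc d) → Set
  Othin i = valency i ≡ 1

  QuasiThin : Set
  QuasiThin = ∀ i → valency i ≤ 2

  Singular : {a : Level} → (Fin (suc d) → Set a) → Set a
  Singular T =
    (∀ i → Othin i → T i) ×
    (∀ x y z → Othin x → T z →
       ∀ w → (((⟦ x ⟧ ⊙ ⟦ y * ⟧) ⊙ ⟦ y ⟧) ⊙ ⟦ z ⟧) w → T w)

module _ {c ℓ : Level} (F : CommutativeRing c ℓ) where
  open CommutativeRing F

  IsField : Set (c ⊔ ℓ)
  IsField = (¬ (1# ≈ 0#)) × (∀ x → ¬ (x ≈ 0#) → ∃[ y ] (x * y ≈ 1#))

  Char2 : Set ℓ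
  Char2 = (1# + 1#) ≈ 0#

  ℕ→F : ℕ → Carrier
  ℕ→F zero    = 0#
  ℕ→F (suc m) = 1# + ℕ→F m

  Σ[_] : {n : ℕ} → (Fin n → Carrier) → Carrier
  Σ[_] {zero}  f = 0#
  Σ[_] {suc n} f = f fzero + Σ[ (λ z → f (fsuc z)) ]

  module _ {n d : ℕ} (S : AssocScheme n d) where
    open AssocScheme S

    -- the (x,y) entry of v = Σ_i c_i A_i
    vEntry : (Fin (suc d) → Carrier) → Fin n → Fin n → Carrier
    vEntry cf x y = cf (rel x y)

    AvEntry : Fin (suc d) → (Fin (suc d) → Carrier) → Fin n → Fin n → Carrier
    AvEntry i cf x y = Σ[ (λ z → if does (rel x z ≟ i) then vEntry cf z y else 0#) ]

    -- ⟨v⟩ is a trivial submodule of the regular FS-module: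
    -- v ≠ 0 and A_i v = k_i v for all i (as matrices over F)
    TrivialVec : (Fin (suc d) → Carrier) → Set ℓ
    TrivialVec cf =
      (∃[ x ] ∃[ y ] ¬ (vEntry cf x y ≈ 0#)) ×
      (∀ i x y → AvEntry i cf x y ≈ ℕ→F (valency i) * vEntry cf x y)

    Supp : (Fin (suc d) → Carrier) → Fin (suc d) → Set ℓ
    Supp cf i = ¬ (cf i ≈ 0#)

-- Write v(a,b) = c_i for (a,b) ∈ R_i.  At (a,b) the equation A_x v = k_x v says that the sum
-- of v(t,b) over the x-neighbours t of a is k_x v(a,b).  For thin R_x there is one neighbour a′,
-- so v(a′,b) = v(a,b).  If a ≠ a′ are y-neighbours of p, then k_y = 2 and characteristic 2 gives
-- v(a,b) + v(a′,b) = 2 v(p,b) = 0, hence v(a,b) = v(a′,b).  Along a path a →x t₁ →y* t₂ →y t₃ →z b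
-- (t₁ and t₃ are y-neighbours of t₂) this yields c_w = v(a,b) = v(t₃,b) = c_z for (a,b) ∈ R_w;
-- and c_x = v(a,b) = v(b,b) = c_0 for (a,b) ∈ R_x puts every thin relation into U(v).
module Submission where

open import Defs
open import Level using (Level)
open import Data.Nat using (ℕ; zero; suc; pred; _≤_; _<_) renaming (_+_ to _+ℕ_)
open import Data.Nat.Properties using (+-suc; +-cancelˡ-≤; n≤0⇒n≡0)
open import Data.Fin using (Fin) renaming (zero to fzero; suc to fsuc)
open import Data.Fin.Properties using (_≟_)
open import Data.Bool using (Bool; true; false; T; if_then_else_; _∧_)
open import Data.Bool.Properties using (T-∧; T-≡)
open import Data.Product using (∃; _×_; _,_; proj₂)
open import Function using (_∘_)
open import Function.Bundles using (Equivalence)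
open import Relation.Nullary using (Dec; does; yes; no)
open import Relation.Nullary.Decidable using (dec-true; dec-false)
open import Relation.Binary.PropositionalEquality
  using (_≡_; _≢_; _≗_; refl; sym; trans; cong; cong₂; subst)
open import Algebra.Bundles using (CommutativeRing)
import Algebra.Properties.Ring as RingProperties
import Algebra.Properties.CommutativeSemigroup as CommutativeSemigroupProperties

T-does⇒ : {a : Level} {A : Set a} (a? : Dec A) → T (does a?) → A
T-does⇒ (yes a) _ = a

T-does⇐ : {a : Level} {A : Set a} (a? : Dec A) → A → T (does a?)
T-does⇐ a? a = Equivalence.from T-≡ (dec-true a? a)

_without_ : {n : ℕ} → (Fin n → Bool) → Fin n → Fin n → Bool
(P without a) t = if does (t ≟ a) then false else P t

without-keeps : {n : ℕ} (P : Fin n → Bool) {a b : Fin n} → b ≢ a → T (P b) → T ((P without a) b)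
without-keeps P {a} {b} b≢a Pb rewrite dec-false (b ≟ a) b≢a = Pb

count-cong : {n : ℕ} {P Q : Fin n → Bool} → P ≗ Q → count P ≡ count Q
count-cong {zero}  _   = refl
count-cong {suc n} P≗Q = cong₂ _+ℕ_ (cong (λ b → if b then 1 else 0) (P≗Q fzero)) (count-cong (P≗Q ∘ fsuc))

count-without : {n : ℕ} (P : Fin n → Bool) (a : Fin n) → T (P a) →
  count P ≡ suc (count (P without a))
count-without {suc n} P fzero Pa with P fzero
... | true = refl
count-without {suc n} P (fsuc a) Pa =
  trans (cong (head +ℕ_) (count-without (P ∘ fsuc) a Pa)) (+-suc head _)
  where
  head : ℕ
  head = if P fzero then 1 else 0

count-witness : {n : ℕ} (P : Fin n → Bool) → 0 < count P → ∃ λ t → T (P t)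
count-witness {suc n} P pos with P fzero in P0
... | true  = fzero , subst T (sym P0) _
... | false with count-witness (P ∘ fsuc) pos
...   | t , Pt = fsuc t , Pt

module _ {n : ℕ} (P : Fin n → Bool) {a b : Fin n} (Pa : T (P a)) (Pb : T (P b)) (a≢b : a ≢ b) where

  count-without₂ : count P ≡ 2 +ℕ count ((P without a) without b)
  count-without₂ =
    trans (count-without P a Pa)
          (cong suc (count-without (P without a) b (without-keeps P (a≢b ∘ sym) Pb)))

  count≤2⇒without₂-empty : count P ≤ 2 → count ((P without a) without b) ≡ 0
  count≤2⇒without₂-empty P≤2 = n≤0⇒n≡0 (+-cancelˡ-≤ 2 _ 0 (subst (_≤ 2) count-without₂ P≤2))

  count≤2⇒count≡2 : count P ≤ 2 → count P ≡ 2
  count≤2⇒count≡2 P≤2 = trans count-without₂ (cong (2 +ℕ_) (count≤2⇒without₂-empty P≤2))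

module FilteredSum {c ℓ : Level} (F : CommutativeRing c ℓ) where
  open CommutativeRing F renaming (refl to ≈-refl; sym to ≈-sym; trans to ≈-trans)
  open import Relation.Binary.Reasoning.Setoid setoid
  open CommutativeSemigroupProperties +-commutativeSemigroup using (x∙yz≈y∙xz)

  sumWhere : {n : ℕ} → (Fin n → Bool) → (Fin n → Carrier) → Carrier
  sumWhere P f = Σ[_] F (λ t → if P t then f t else 0#)

  sumWhere-without : {n : ℕ} (P : Fin n → Bool) (f : Fin n → Carrier) (a : Fin n) → T (P a) →
    sumWhere P f ≈ f a + sumWhere (P without a) f
  sumWhere-without {suc n} P f fzero Pa with P fzero
  ... | true = +-congˡ (≈-sym (+-identityˡ _))
  sumWhere-without {suc n} P f (fsuc a) Pa =
    ≈-trans (+-congˡ (sumWhere-without (P ∘ fsuc) (f ∘ fsuc) a Pa)) (x∙yz≈y∙xz _ _ _)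

  sumWhere-none : {n : ℕ} (P : Fin n → Bool) (f : Fin n → Carrier) → count P ≡ 0 → sumWhere P f ≈ 0#
  sumWhere-none {zero}  P f _ = ≈-refl
  sumWhere-none {suc n} P f none with P fzero
  ... | false = ≈-trans (+-identityˡ _) (sumWhere-none (P ∘ fsuc) (f ∘ fsuc) none)

  sumWhere-single : {n : ℕ} (P : Fin n → Bool) (f : Fin n → Carrier) {a : Fin n} → T (P a) →
    count P ≡ 1 → sumWhere P f ≈ f a
  sumWhere-single P f {a} Pa one = begin
    sumWhere P f                    ≈⟨ sumWhere-without P f a Pa ⟩
    f a + sumWhere (P without a) f  ≈⟨ +-congˡ (sumWhere-none (P without a) f rest-empty) ⟩
    f a + 0#                        ≈⟨ +-identityʳ (f a) ⟩
    f a                             ∎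
    where
    rest-empty : count (P without a) ≡ 0
    rest-empty = cong pred (trans (sym (count-without P a Pa)) one)

  sumWhere-pair : {n : ℕ} (P : Fin n → Bool) (f : Fin n → Carrier) {a b : Fin n} →
    T (P a) → T (P b) → a ≢ b → count P ≤ 2 → sumWhere P f ≈ f a + f b
  sumWhere-pair {n} P f {a} {b} Pa Pb a≢b P≤2 = begin
    sumWhere P f                                ≈⟨ sumWhere-without P f a Pa ⟩
    f a + sumWhere (P without a) f              ≈⟨ +-congˡ (sumWhere-without (P without a) f b Pb′) ⟩
    f a + (f b + sumWhere Q f)                  ≈⟨ +-congˡ (+-congˡ (sumWhere-none Q f Q-empty)) ⟩
    f a + (f b + 0#)                            ≈⟨ +-congˡ (+-identityʳ (f b)) ⟩
    f a + f b                                   ∎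
    where
    Q : Fin n → Bool
    Q = (P without a) without b
    Pb′ : T ((P without a) b)
    Pb′ = without-keeps P (a≢b ∘ sym) Pb
    Q-empty : count Q ≡ 0
    Q-empty = count≤2⇒without₂-empty P Pa Pb a≢b P≤2

module Characteristic2 {c ℓ : Level} (F : CommutativeRing c ℓ) (char2 : Char2 F) where
  open CommutativeRing F renaming (refl to ≈-refl; sym to ≈-sym; trans to ≈-trans)
  open RingProperties ring using (+-inverseˡ-unique)
  open import Relation.Binary.Reasoning.Setoid setoid

  two*x≈0 : ∀ x → ℕ→F F 2 * x ≈ 0#
  two*x≈0 x = begin
    (1# + (1# + 0#)) * x ≈⟨ *-congʳ (+-congˡ (+-identityʳ 1#)) ⟩
    (1# + 1#) * x        ≈⟨ *-congʳ char2 ⟩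
    0# * x               ≈⟨ zeroˡ x ⟩
    0#                   ∎

  x+x≈0 : ∀ x → x + x ≈ 0#
  x+x≈0 x = begin
    x + x              ≈⟨ +-cong (*-identityˡ x) (*-identityˡ x) ⟨
    1# * x + 1# * x    ≈⟨ distribʳ x 1# 1# ⟨
    (1# + 1#) * x      ≈⟨ *-congʳ char2 ⟩
    0# * x             ≈⟨ zeroˡ x ⟩
    0#                 ∎

  x+y≈0⇒x≈y : ∀ {x y} → x + y ≈ 0# → x ≈ y
  x+y≈0⇒x≈y {x} {y} x+y≈0 =
    ≈-trans (+-inverseˡ-unique x y x+y≈0) (≈-sym (+-inverseˡ-unique y y (x+x≈0 y)))

module SchemeFacts {n d : ℕ} (S : AssocScheme n d) where
  open AssocScheme S

  rel-diag : ∀ x → rel x x ≡ fzero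
  rel-diag x = Equivalence.from (diagonal x x) refl

  rel-swap : ∀ {i a b} → rel a b ≡ i → rel b a ≡ i *
  rel-swap {a = a} {b} r = trans (transp a b) (cong _* r)

  *-involutive : ∀ i → (i *) * ≡ i
  *-involutive i with nonempty i
  ... | x , y , refl = trans (sym (cong _* (transp x y))) (sym (transp y x))

  neighbours : Fin (suc d) → Fin n → Fin n → Bool
  neighbours i a t = does (rel a t ≟ i)

  count-neighbours : ∀ i a → count (neighbours i a) ≡ valency i
  count-neighbours i a =
    trans (count-cong back-too) (p-count i (i *) fzero a a (rel-diag a))
    where
    back-too : ∀ t → neighbours i a t ≡ (neighbours i a t ∧ does (rel t a ≟ i *))
    back-too t with rel a t ≟ i
    ... | yes r = sym (dec-true (rel t a ≟ i *) (rel-swap r))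
    ... | no _  = refl

  factor-path : ∀ {u v w a b} → rel a b ≡ w → 0 < p u v w → ∃ λ t → rel a t ≡ u × rel t b ≡ v
  factor-path {u} {v} {w} {a} {b} r pos
    with count-witness _ (subst (0 <_) (sym (p-count u v w a b r)) pos)
  ... | t , on-path with Equivalence.to (T-∧ {does (rel a t ≟ u)}) on-path
  ...   | au , tb = t , T-does⇒ (rel a t ≟ u) au , T-does⇒ (rel t b ≟ v) tb

module EigenvectorEntries {c ℓ : Level} (F : CommutativeRing c ℓ) {n d : ℕ} (S : AssocScheme n d)
  (cf : Fin (suc d) → CommutativeRing.Carrier F) (trivial : TrivialVec F S cf) where
  open CommutativeRing F renaming (refl to ≈-refl; sym to ≈-sym; trans to ≈-trans)
  open AssocScheme S
  open SchemeFacts S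
  open FilteredSum F
  open Characteristic2 F
  open import Relation.Binary.Reasoning.Setoid setoid

  V : Fin n → Fin n → Carrier
  V = vEntry F S cf

  eigen : ∀ i a b → sumWhere (neighbours i a) (λ t → V t b) ≈ ℕ→F F (valency i) * V a b
  eigen = proj₂ trivial

  thin-neighbour : ∀ {x a a′ b} → Othin x → rel a a′ ≡ x → V a′ b ≈ V a b
  thin-neighbour {x} {a} {a′} {b} thin r = begin
    V a′ b                                   ≈⟨ sumWhere-single N (λ t → V t b) Na′ N≡1 ⟨
    sumWhere N (λ t → V t b)                 ≈⟨ eigen x a b ⟩
    ℕ→F F (valency x) * V a b                ≡⟨ cong (λ k → ℕ→F F k * V a b) thin ⟩
    (1# + 0#) * V a b                        ≈⟨ *-congʳ (+-identityʳ 1#) ⟩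
    1# * V a b                               ≈⟨ *-identityˡ (V a b) ⟩
    V a b                                    ∎
    where
    N : Fin n → Bool
    N = neighbours x a
    Na′ : T (N a′)
    Na′ = T-does⇐ (rel a a′ ≟ x) r
    N≡1 : count N ≡ 1
    N≡1 = trans (count-neighbours x a) thin

  twin-neighbours : Char2 F → QuasiThin → ∀ {y p a a′ b} → rel p a ≡ y → rel p a′ ≡ y → V a b ≈ V a′ b
  twin-neighbours char2 qt {y} {p} {a} {a′} {b} r r′ with a ≟ a′
  ... | yes refl = ≈-refl
  ... | no a≢a′ = x+y≈0⇒x≈y char2 (begin
    V a b + V a′ b                           ≈⟨ sumWhere-pair N (λ t → V t b) Na Na′ a≢a′ N≤2 ⟨
    sumWhere N (λ t → V t b)                 ≈⟨ eigen y p b ⟩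
    ℕ→F F (valency y) * V p b                ≡⟨ cong (λ k → ℕ→F F k * V p b) k≡2 ⟩
    ℕ→F F 2 * V p b                          ≈⟨ two*x≈0 char2 (V p b) ⟩
    0#                                       ∎)
    where
    N : Fin n → Bool
    N = neighbours y p
    Na : T (N a)
    Na = T-does⇐ (rel p a ≟ y) r
    Na′ : T (N a′)
    Na′ = T-does⇐ (rel p a′ ≟ y) r′
    N≤2 : count N ≤ 2
    N≤2 = subst (_≤ 2) (sym (count-neighbours y p)) (qt y)
    k≡2 : valency y ≡ 2
    k≡2 = trans (sym (count-neighbours y p)) (count≤2⇒count≡2 N Na Na′ a≢a′ N≤2)

  Supp-resp : ∀ {i j} → cf i ≈ cf j → Supp F S cf j → Supp F S cf i
  Supp-resp i≈j j∈U i≈0 = j∈U (≈-trans (≈-sym i≈j) i≈0)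

  Othin⊆Supp : Supp F S cf fzero → ∀ i → Othin i → Supp F S cf i
  Othin⊆Supp R₀∈U i thin with nonempty i
  ... | a , b , refl = Supp-resp (begin
    V a b                                    ≈⟨ thin-neighbour thin refl ⟨
    V b b                                    ≡⟨ cong cf (rel-diag b) ⟩
    cf fzero                                 ∎) R₀∈U

  Supp-closed : Char2 F → QuasiThin → ∀ x y z → Othin x → Supp F S cf z →
    ∀ w → (((⟦ x ⟧ ⊙ ⟦ y * ⟧) ⊙ ⟦ y ⟧) ⊙ ⟦ z ⟧) w → Supp F S cf w
  Supp-closed char2 qt x y z thin z∈U w
    (u , _ , (u′ , _ , (_ , _ , refl , refl , x·y*→u′) , refl , u′·y→u) , refl , u·z→w)
    with nonempty w
  ... | a , b , refl with factor-path refl u·z→w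
  ... | t₃ , at₃ , t₃b with factor-path at₃ u′·y→u
  ... | t₂ , at₂ , t₂t₃ with factor-path at₂ x·y*→u′
  ... | t₁ , at₁ , t₁t₂ = Supp-resp (begin
    V a b                                    ≈⟨ thin-neighbour thin at₁ ⟨
    V t₁ b                                   ≈⟨ twin-neighbours char2 qt t₂t₁ t₂t₃ ⟩
    V t₃ b                                   ≡⟨ cong cf t₃b ⟩
    cf z                                     ∎) z∈U
    where
    t₂t₁ : rel t₂ t₁ ≡ y
    t₂t₁ = subst (rel t₂ t₁ ≡_) (*-involutive y) (rel-swap t₁t₂)

lemma3p13 : {c ℓ : Level} (F : CommutativeRing c ℓ) → IsField F → Char2 F →
    {n d : ℕ} (S : AssocScheme n d) → AssocScheme.QuasiThin S →
    (cf : Fin (suc d) → CommutativeRing.Carrier F) → TrivialVec F S cf →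
    Supp F S cf fzero →
    AssocScheme.Singular S (Supp F S cf)
lemma3p13 F _ char2 S qt cf trivial R₀∈U = Othin⊆Supp R₀∈U , Supp-closed char2 qt
  where open EigenvectorEntries F S cf trivial
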